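{- Let $H$ be a linear hypergraph and $\mathscr{N}$ a finite set of subhypergraphs of $H$ partitioned as $\mathscr{N}=\mathscr{A}\,\dot\cup\,\mathscr{B}$ such that $V(\mathscr{A})\cap V(\mathscr{B})\subseteq e$ for some edge $e$ of $H$. If both $\mathscr{A}\cup\{e^+\}$ and $\mathscr{B}\cup\{e^+\}$ are forests of copies, then so is $\mathscr{N}$.
   Context: Hypergraphs are pairs $(V,E)$ with $E$ a set of $k$-subsets of a finite set $V$; linear means two distinct edges share at most one vertex. For $e\in E(H)$, $e^+=(e,\{e\})$. For a set $\mathscr{M}$ of subhypergraphs, $V(\mathscr{M})=\bigcup_{F\in\mathscr{M}}V(F)$. An enumeration $(F_1,\dots,F_{|\mathscr{M}|})$ of $\mathscr{M}$ is admissible if for every $j\in[2,|\mathscr{M}|]$ the set $z_j=V(F_j)\cap\bigcup_{i<j}V(F_i)$ either is an edge in $E(F_j)\cap\bigcup_{i<j}E(F_i)$ or has at most one element; $\mathscr{M}$ is a forest of copies if it has an admissible enumeration. -}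

module Defs where

open import Data.Nat using (ℕ; _≤_)
open import Data.Fin using (Fin)
open import Data.Fin.Subset using (Subset; _∩_; ⋃; ∣_∣) renaming (_∈_ to _∈ₛ_; _⊆_ to _⊆ₛ_)
open import Data.List using (List; []; _∷_; _++_; [_]; map)
open import Data.List.Membership.Propositional using (_∈_)
open import Data.List.Relation.Unary.Any using (Any)
open import Data.List.Relation.Unary.AllPairs using (AllPairs)
open import Data.Product using (Σ; _×_; ∃; ∃-syntax)
open import Data.Sum using (_⊎_)
open import Data.Unit using (⊤)
open import Relation.Nullary using (¬_)
open import Relation.Binary.PropositionalEquality using (_≡_)

-- A (finite) hypergraph whose vertex set is a subset of Fin n.
-- Edges are subsets of Fin n; the edge *set* is represented by a list
-- (only membership matters; duplicates are irrelevant).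
record Hyp (n : ℕ) : Set where
  constructor hyp
  field
    verts : Subset n
    edges : List (Subset n)
open Hyp public

IsUniformHypergraph : ∀ {n} → ℕ → Hyp n → Set
IsUniformHypergraph k H = ∀ f → f ∈ edges H → (f ⊆ₛ verts H) × (∣ f ∣ ≡ k)

IsLinear : ∀ {n} → Hyp n → Set
IsLinear H = ∀ f g → f ∈ edges H → g ∈ edges H → ¬ (f ≡ g) → ∣ f ∩ g ∣ ≤ 1

IsSubhypergraph : ∀ {n} → Hyp n → Hyp n → Set
IsSubhypergraph F H =
  (verts F ⊆ₛ verts H) × (∀ f → f ∈ edges F → f ∈ edges H) × (∀ f → f ∈ edges F → f ⊆ₛ verts F)

_≈H_ : ∀ {n} → Hyp n → Hyp n → Set
F ≈H G = (verts F ≡ verts G) × (∀ f → f ∈ edges F → f ∈ edges G) × (∀ f → f ∈ edges G → f ∈ edges F)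

_⁺ : ∀ {n} → Subset n → Hyp n
e ⁺ = hyp e [ e ]

Vfam : ∀ {n} → List (Hyp n) → Subset n
Vfam 𝓜 = ⋃ (map verts 𝓜)

-- Condition on the j-th copy F given the earlier copies prev = (F_1,...,F_{j-1}):
-- z = V(F) ∩ ⋃_{i<j} V(F_i) is an edge in E(F) ∩ ⋃_{i<j} E(F_i), or |z| ≤ 1.
AdmStep : ∀ {n} → List (Hyp n) → Hyp n → Set
AdmStep prev F =
  (let z = verts F ∩ Vfam prev in
    (z ∈ edges F × Any (λ G → z ∈ edges G) prev) ⊎ (∣ z ∣ ≤ 1))

AdmFrom : ∀ {n} → List (Hyp n) → List (Hyp n) → Set
AdmFrom prev [] = ⊤
AdmFrom prev (F ∷ rest) = AdmStep prev F × AdmFrom (prev ++ [ F ]) rest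

-- An enumeration (list) is admissible (the condition for j = 1 is vacuous: z = ∅).
Admissible : ∀ {n} → List (Hyp n) → Set
Admissible M = AdmFrom [] M

-- M is an enumeration of the set of elements of L (up to hypergraph equality):
-- no repetitions, and the same members.
IsEnumerationOf : ∀ {n} → List (Hyp n) → List (Hyp n) → Set
IsEnumerationOf M L =
  AllPairs (λ F G → ¬ (F ≈H G)) M
  × (∀ F → F ∈ L → Any (F ≈H_) M)
  × (∀ G → G ∈ M → Any (G ≈H_) L)

IsForestOfCopies : ∀ {n} → List (Hyp n) → Set
IsForestOfCopies L = ∃[ M ] (IsEnumerationOf M L × Admissible M)

{-# OPTIONS --safe #-}
module Submission where

-- In an admissible enumeration every copy after the first meets its predecessors inside
-- a single earlier copy (its parent), so the enumeration can be rearranged to start at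
-- any prescribed copy.  Start the enumerations of e⁺ ∪ 𝓐 and e⁺ ∪ 𝓑 at e⁺.  The copy e⁺
-- can be dropped from the first one: reroot that enumeration at a copy having e as an
-- edge, if any, so that e⁺ no longer contributes anything new.  Since V(𝓐) ∩ V(𝓑) ⊆ e, the copies of 𝓑
-- that followed e⁺ can then be appended to the enumeration of 𝓐 with e⁺ replaced by the
-- whole of 𝓐.  A 𝓑-copy attached along the edge e needs e to be an edge of some 𝓐-copy;
-- when no 𝓐-copy has e as an edge, the roles of 𝓐 and 𝓑 are exchanged.

open import Defs
open import Data.Bool using () renaming (_≟_ to _≟ᵇ_)
open import Data.Empty using (⊥-elim)
open import Data.Fin as Fin using (Fin)
open import Data.Fin.Subset using (Subset; _∩_; ⊥; ∣_∣; ⁅_⁆; Empty)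
  renaming (_∈_ to _∈ₛ_; _⊆_ to _⊆ₛ_)
open import Data.Fin.Subset.Properties
  using ( x∈p∩q⁺; x∈p∩q⁻; x∈p∪q⁺; x∈p∪q⁻; ∉⊥; ⊆-antisym; p⊆q⇒∣p∣≤∣q∣; p⊂q⇒∣p∣<∣q∣
        ; nonempty?; ∣p∩q∣≤∣q∣; ∣⊥∣≡0; ∣⁅x⁆∣≡1; x∈⁅y⁆⇒x≡y; x≢y⇒x∉⁅y⁆ )
open import Data.List using (List; []; _∷_; _++_; [_])
open import Data.List.Properties using (++-assoc; ++-identityʳ)
open import Data.List.Reverse using (Reverse; []; _∶_∶ʳ_; reverseView)
open import Data.List.Membership.Propositional using (_∈_; find; lose)
open import Data.List.Membership.Propositional.Properties using (∈-++⁺ˡ; ∈-++⁺ʳ; ∈-++⁻; ∈-∃++)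
import Data.List.Membership.DecPropositional as DecMembership
open import Data.List.Relation.Unary.Any as Any using (Any; here; there)
open import Data.List.Relation.Unary.Any.Properties using (++⁺ˡ; ++⁺ʳ; ++⁻)
import Data.List.Relation.Unary.All as All
open import Data.List.Relation.Unary.AllPairs as AllPairs using (AllPairs)
import Data.List.Relation.Unary.AllPairs.Properties as AllPairs
open import Data.List.Relation.Binary.Permutation.Propositional
  using (_↭_; prep; ↭-refl; ↭-sym; ↭-trans; ↭⇒↭ₛ)
open import Data.List.Relation.Binary.Permutation.Propositional.Properties
  using (Any-resp-↭; ∈-resp-↭; ++-comm; shift; drop-∷; ∷↭∷ʳ)
  renaming (++⁺ʳ to ↭-++⁺ʳ)
import Data.List.Relation.Binary.Permutation.Setoid.Properties as PermutationSetoid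
import Data.List.Relation.Binary.Subset.DecPropositional as DecSubset
open import Data.Nat using (ℕ; _≤_; _<_; z≤n)
open import Data.Nat.Properties using (≤-trans; <⇒≱)
open import Data.Product using (_×_; _,_; proj₁; proj₂; ∃; ∃-syntax)
import Data.Product as Prod
open import Data.Sum using (_⊎_; inj₁; inj₂; [_,_]′)
import Data.Sum as Sum
open import Data.Unit using (tt)
open import Data.Vec.Properties using (≡-dec)
open import Function using (_∘_; id)
open import Relation.Nullary using (¬_; Dec; yes; no; contradiction)
open import Relation.Nullary.Decidable using (map′; _×-dec_)
open import Relation.Binary.PropositionalEquality using (_≡_; refl; sym; subst; setoid; resp₂)

private
  variable
    n : ℕ
    e : Subset n
    E F x : Hyp n
    p p′ R xs ys 𝓐 𝓑 : List (Hyp n)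

∩⁻ˡ : ∀ {v} {s t : Subset n} → v ∈ₛ s ∩ t → v ∈ₛ s
∩⁻ˡ = proj₁ ∘ x∈p∩q⁻ _ _

∩⁻ʳ : ∀ {v} {s t : Subset n} → v ∈ₛ s ∩ t → v ∈ₛ t
∩⁻ʳ = proj₂ ∘ x∈p∩q⁻ _ _

∣s∣≤1⇒≡ : (s : Subset n) {v w : Fin n} → ∣ s ∣ ≤ 1 → v ∈ₛ s → w ∈ₛ s → v ≡ w
∣s∣≤1⇒≡ s {v} {w} ∣s∣≤1 v∈s w∈s with v Fin.≟ w
... | yes v≡w = v≡w
... | no v≢w = contradiction ∣s∣≤1 (<⇒≱ (subst (_< ∣ s ∣) (∣⁅x⁆∣≡1 v) ⁅v⁆⊂s))
  where
  ⁅v⁆⊂s : ∣ ⁅ v ⁆ ∣ < ∣ s ∣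
  ⁅v⁆⊂s = p⊂q⇒∣p∣<∣q∣ ( (λ u∈⁅v⁆ → subst (_∈ₛ s) (sym (x∈⁅y⁆⇒x≡y v u∈⁅v⁆)) v∈s)
                      , w , w∈s , x≢y⇒x∉⁅y⁆ (v≢w ∘ sym) )

_≟ₛ_ : (s t : Subset n) → Dec (s ≡ t)
_≟ₛ_ = ≡-dec _≟ᵇ_

Vfam⁺ : ∀ {v} → Any (λ G → v ∈ₛ verts G) p → v ∈ₛ Vfam p
Vfam⁺ (here v∈G) = x∈p∪q⁺ (inj₁ v∈G)
Vfam⁺ (there v∈p) = x∈p∪q⁺ (inj₂ (Vfam⁺ v∈p))

Vfam⁻ : ∀ {v} (p : List (Hyp n)) → v ∈ₛ Vfam p → Any (λ G → v ∈ₛ verts G) p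
Vfam⁻ [] v∈⊥ = ⊥-elim (∉⊥ v∈⊥)
Vfam⁻ (G ∷ p) v∈ with x∈p∪q⁻ (verts G) (Vfam p) v∈
... | inj₁ v∈G = here v∈G
... | inj₂ v∈p = there (Vfam⁻ p v∈p)

∈-Vfam : ∀ {G v} → G ∈ p → v ∈ₛ verts G → v ∈ₛ Vfam p
∈-Vfam G∈p v∈G = Vfam⁺ (Any.map (λ { refl → v∈G }) G∈p)

Vfam-mono : (∀ {G} → G ∈ p → G ∈ p′) → Vfam p ⊆ₛ Vfam p′
Vfam-mono {p = p} p⊆p′ v∈ with find (Vfam⁻ p v∈)
... | G , G∈p , v∈G = ∈-Vfam (p⊆p′ G∈p) v∈G

Vfam-++⁻ : ∀ {v} (p : List (Hyp n)) → v ∈ₛ Vfam (p ++ p′) → v ∈ₛ Vfam p ⊎ v ∈ₛ Vfam p′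
Vfam-++⁻ p v∈ = Sum.map Vfam⁺ Vfam⁺ (++⁻ p (Vfam⁻ _ v∈))

Vfam-[-]⁻ : ∀ {v} (F : Hyp n) → v ∈ₛ Vfam [ F ] → v ∈ₛ verts F
Vfam-[-]⁻ F v∈ with Vfam⁻ [ F ] v∈
... | here v∈F = v∈F

Vfam-resp-↭ : p ↭ p′ → Vfam p ≡ Vfam p′
Vfam-resp-↭ p↭p′ = ⊆-antisym (Vfam-mono (∈-resp-↭ p↭p′)) (Vfam-mono (∈-resp-↭ (↭-sym p↭p′)))

≈H-sym : {F G : Hyp n} → F ≈H G → G ≈H F
≈H-sym (V≡ , E⊆ , E⊇) = sym V≡ , E⊇ , E⊆

≈H-trans : {F G K : Hyp n} → F ≈H G → G ≈H K → F ≈H K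
≈H-trans (refl , E⊆ , E⊇) (refl , E⊆′ , E⊇′) = refl , (λ f → E⊆′ f ∘ E⊆ f) , (λ f → E⊇ f ∘ E⊇′ f)

≈H-dec : (F G : Hyp n) → Dec (F ≈H G)
≈H-dec F G = map′ to from (verts F ≟ₛ verts G ×-dec edges F ⊆? edges G ×-dec edges G ⊆? edges F)
  where
  open DecSubset _≟ₛ_ using (_⊆_; _⊆?_)
  to : verts F ≡ verts G × edges F ⊆ edges G × edges G ⊆ edges F → F ≈H G
  to (V≡ , E⊆ , E⊇) = V≡ , (λ _ → E⊆) , (λ _ → E⊇)
  from : F ≈H G → verts F ≡ verts G × edges F ⊆ edges G × edges G ⊆ edges F
  from (V≡ , E⊆ , E⊇) = V≡ , E⊆ _ , E⊇ _

edge? : (e : Subset n) (G : Hyp n) → Dec (e ∈ edges G)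
edge? e G = e ∈? edges G
  where open DecMembership _≟ₛ_ using (_∈?_)

≈H-verts : ∀ {v} {F G : Hyp n} → F ≈H G → v ∈ₛ verts F → v ∈ₛ verts G
≈H-verts (V≡ , _) = subst (_ ∈ₛ_) V≡

≈H-edges : ∀ {f} {F G : Hyp n} → F ≈H G → f ∈ edges F → f ∈ edges G
≈H-edges (_ , E⊆ , _) = E⊆ _

edge-of-copy : ∀ {f} → E ≈H (e ⁺) → f ∈ edges E → f ≡ e
edge-of-copy (_ , E⊆ , _) f∈E with E⊆ _ f∈E
... | here f≡e = f≡e

copy⇒edge : Any ((e ⁺) ≈H_) 𝓐 → Any (λ A → e ∈ edges A) 𝓐
copy⇒edge = Any.map (λ e⁺≈A → ≈H-edges e⁺≈A (here refl))

WellFormed : Hyp n → Set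
WellFormed G = ∀ f → f ∈ edges G → f ⊆ₛ verts G

AllWellFormed : List (Hyp n) → Set
AllWellFormed p = ∀ {G} → G ∈ p → WellFormed G

⁺-wellFormed : WellFormed (e ⁺)
⁺-wellFormed _ (here refl) = id

wellFormed-resp-≈H : {F G : Hyp n} → F ≈H G → WellFormed G → WellFormed F
wellFormed-resp-≈H F≈G wf f f∈F = ≈H-verts (≈H-sym F≈G) ∘ wf f (≈H-edges F≈G f∈F)

edge⊆Vfam : ∀ {f} → AllWellFormed p → Any (λ G → f ∈ edges G) p → f ⊆ₛ Vfam p
edge⊆Vfam wf f∈p with find f∈p
... | G , G∈p , f∈G = ∈-Vfam G∈p ∘ wf G∈p _ f∈G

module _ {P : Hyp n → Set} (P-resp : ∀ {F G} → F ≈H G → P F → P G) {M 𝓐 : List (Hyp n)}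
         (enum : IsEnumerationOf M 𝓐) where

  Any-resp-enumeration : Any P 𝓐 → Any P M
  Any-resp-enumeration P𝓐 with find P𝓐
  ... | A , A∈ , PA = Any.map (λ A≈G → P-resp A≈G PA) (proj₁ (proj₂ enum) A A∈)

  Any-resp-enumeration⁻ : Any P M → Any P 𝓐
  Any-resp-enumeration⁻ PM with find PM
  ... | G , G∈ , PG = Any.map (λ G≈A → P-resp G≈A PG) (proj₂ (proj₂ enum) G G∈)

Vfam-enumeration : ∀ {M} → IsEnumerationOf M 𝓐 → Vfam M ⊆ₛ Vfam 𝓐
Vfam-enumeration enum = Vfam⁺ ∘ Any-resp-enumeration⁻ ≈H-verts enum ∘ Vfam⁻ _

enumeration-wellFormed : ∀ {M} → IsEnumerationOf M 𝓐 → AllWellFormed 𝓐 → AllWellFormed M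
enumeration-wellFormed (_ , _ , back) wf G∈M with find (back _ G∈M)
... | A , A∈ , G≈A = wellFormed-resp-≈H G≈A (wf A∈)

IsEnumerationOf-resp-↭ˡ : ∀ {M M′} → M ↭ M′ → IsEnumerationOf M 𝓐 → IsEnumerationOf M′ 𝓐
IsEnumerationOf-resp-↭ˡ M↭M′ (distinct , cover , back) =
  PermutationSetoid.AllPairs-resp-↭ (setoid _) (λ F≉G → F≉G ∘ ≈H-sym) (resp₂ _) (↭⇒↭ₛ M↭M′) distinct
  , (λ A → Any-resp-↭ M↭M′ ∘ cover A)
  , (λ G → back G ∘ ∈-resp-↭ (↭-sym M↭M′))

IsEnumerationOf-resp-↭ʳ : ∀ {M} → 𝓐 ↭ 𝓑 → IsEnumerationOf M 𝓐 → IsEnumerationOf M 𝓑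
IsEnumerationOf-resp-↭ʳ 𝓐↭𝓑 (distinct , cover , back) =
  distinct , (λ A → cover A ∘ ∈-resp-↭ (↭-sym 𝓐↭𝓑)) , (λ G → Any-resp-↭ 𝓐↭𝓑 ∘ back G)

IsEnumerationOf-++ : ∀ {M N} → IsEnumerationOf M 𝓐 → IsEnumerationOf N 𝓑
  → (∀ A B → A ∈ 𝓐 → B ∈ 𝓑 → ¬ (A ≈H B)) → IsEnumerationOf (M ++ N) (𝓐 ++ 𝓑)
IsEnumerationOf-++ {𝓐 = 𝓐} {M = M} {N} (distinct , cover , back) (distinct′ , cover′ , back′)
                   disjoint =
  AllPairs.++⁺ distinct distinct′ (All.tabulate λ G∈M → All.tabulate λ K∈N → separated G∈M K∈N)
  , (λ F → [ ++⁺ˡ ∘ cover F , ++⁺ʳ M ∘ cover′ F ]′ ∘ ∈-++⁻ 𝓐)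
  , (λ G → [ ++⁺ˡ ∘ back G , ++⁺ʳ 𝓐 ∘ back′ G ]′ ∘ ∈-++⁻ M)
  where
  separated : ∀ {G K} → G ∈ M → K ∈ N → ¬ (G ≈H K)
  separated G∈M K∈N G≈K with find (back _ G∈M) | find (back′ _ K∈N)
  ... | A , A∈ , G≈A | B , B∈ , K≈B =
    disjoint A B A∈ B∈ (≈H-trans (≈H-sym G≈A) (≈H-trans G≈K K≈B))

IsForestOfCopies-++-comm : ∀ 𝓐 𝓑 → IsForestOfCopies (𝓑 ++ 𝓐) → IsForestOfCopies {n} (𝓐 ++ 𝓑)
IsForestOfCopies-++-comm 𝓐 𝓑 (M , enum , adm) =
  M , IsEnumerationOf-resp-↭ʳ (++-comm 𝓑 𝓐) enum , adm

AdmStep-[] : (F : Hyp n) → AdmStep [] F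
AdmStep-[] {n} F = inj₂ (≤-trans (∣p∩q∣≤∣q∣ (verts F) ⊥) (subst (_≤ 1) (sym (∣⊥∣≡0 n)) z≤n))

AdmStep-resp-↭ : p ↭ p′ → AdmStep p F → AdmStep p′ F
AdmStep-resp-↭ {p′ = p′} {F = F} p↭p′ step =
  subst (λ V → (verts F ∩ V ∈ edges F × Any (λ G → verts F ∩ V ∈ edges G) p′) ⊎ ∣ verts F ∩ V ∣ ≤ 1)
        (Vfam-resp-↭ p↭p′) (Sum.map₁ (Prod.map₂ (Any-resp-↭ p↭p′)) step)

AdmFrom-++⁻ : ∀ p xs → AdmFrom p (xs ++ ys) → AdmFrom p xs × AdmFrom (p ++ xs) ys
AdmFrom-++⁻ {ys = ys} p [] adm = tt , subst (λ q → AdmFrom q ys) (sym (++-identityʳ p)) adm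
AdmFrom-++⁻ {ys = ys} p (x ∷ xs) (step , adm) with AdmFrom-++⁻ (p ++ [ x ]) xs adm
... | adm-xs , adm-ys = (step , adm-xs) , subst (λ q → AdmFrom q ys) (++-assoc p [ x ] xs) adm-ys

AdmFrom-++⁺ : ∀ p xs → AdmFrom p xs → AdmFrom (p ++ xs) ys → AdmFrom p (xs ++ ys)
AdmFrom-++⁺ {ys = ys} p [] _ adm = subst (λ q → AdmFrom q ys) (++-identityʳ p) adm
AdmFrom-++⁺ {ys = ys} p (x ∷ xs) (step , adm-xs) adm-ys =
  step , AdmFrom-++⁺ (p ++ [ x ]) xs adm-xs
                      (subst (λ q → AdmFrom q ys) (sym (++-assoc p [ x ] xs)) adm-ys)

AdmStep-transfer : (∀ {v} → v ∈ₛ verts F → v ∈ₛ Vfam p′ → v ∈ₛ Vfam p)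
  → (∀ f → f ∈ edges F → Any (λ G → f ∈ edges G) p → f ⊆ₛ Vfam p′ × Any (λ G → f ∈ edges G) p′)
  → AdmStep p F → AdmStep p′ F
AdmStep-transfer {F = F} {p′} {p} inVfam _ (inj₂ ∣z∣≤1) =
  inj₂ (≤-trans (p⊆q⇒∣p∣≤∣q∣ (λ v∈ → x∈p∩q⁺ (∩⁻ˡ v∈ , inVfam (∩⁻ˡ v∈) (∩⁻ʳ v∈)))) ∣z∣≤1)
AdmStep-transfer {F = F} {p′} {p} inVfam inEdges (inj₁ (z∈F , z∈p)) with inEdges _ z∈F z∈p
... | z⊆p′ , z∈p′ = inj₁ (subst (λ z → z ∈ edges F × Any (λ G → z ∈ edges G) p′) z≡z′ (z∈F , z∈p′))
  where
  z≡z′ : verts F ∩ Vfam p ≡ verts F ∩ Vfam p′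
  z≡z′ = ⊆-antisym (λ v∈ → x∈p∩q⁺ (∩⁻ˡ v∈ , z⊆p′ v∈))
                   (λ v∈ → x∈p∩q⁺ (∩⁻ˡ v∈ , inVfam (∩⁻ˡ v∈) (∩⁻ʳ v∈)))

AdmFrom-transfer : AllWellFormed R
  → (∀ {F} → F ∈ R → ∀ {v} → v ∈ₛ verts F → v ∈ₛ Vfam p′ → v ∈ₛ Vfam p)
  → (∀ {F} → F ∈ R → ∀ f → f ∈ edges F → Any (λ G → f ∈ edges G) p
       → f ⊆ₛ Vfam p′ × Any (λ G → f ∈ edges G) p′)
  → AdmFrom p R → AdmFrom p′ R
AdmFrom-transfer {R = []} _ _ _ _ = tt
AdmFrom-transfer {R = F ∷ R} {p′} {p} wf inVfam inEdges (step , adm) =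
  AdmStep-transfer (inVfam (here refl)) (inEdges (here refl)) step ,
  AdmFrom-transfer (wf ∘ there) inVfam′ inEdges′ adm
  where
  inVfam′ : ∀ {G} → G ∈ R → ∀ {v} → v ∈ₛ verts G → v ∈ₛ Vfam (p′ ++ [ F ]) → v ∈ₛ Vfam (p ++ [ F ])
  inVfam′ G∈R v∈G v∈ with Vfam-++⁻ p′ v∈
  ... | inj₁ v∈p′ = Vfam-mono {p = p} ∈-++⁺ˡ (inVfam (there G∈R) v∈G v∈p′)
  ... | inj₂ v∈F = Vfam-mono {p = [ F ]} (∈-++⁺ʳ p) v∈F
  wf-F : AllWellFormed [ F ]
  wf-F (here refl) = wf (here refl)
  inEdges′ : ∀ {G} → G ∈ R → ∀ f → f ∈ edges G → Any (λ K → f ∈ edges K) (p ++ [ F ])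
    → f ⊆ₛ Vfam (p′ ++ [ F ]) × Any (λ K → f ∈ edges K) (p′ ++ [ F ])
  inEdges′ G∈R f f∈G f∈ with ++⁻ p f∈
  ... | inj₂ f∈[F] = (λ v∈ → Vfam-mono {p = [ F ]} (∈-++⁺ʳ p′) (edge⊆Vfam wf-F f∈[F] v∈))
                   , ++⁺ʳ p′ f∈[F]
  ... | inj₁ f∈p with inEdges (there G∈R) f f∈G f∈p
  ...   | f⊆p′ , f∈p′ = (λ v∈ → Vfam-mono {p = p′} ∈-++⁺ˡ (f⊆p′ v∈)) , ++⁺ˡ f∈p′

AdmFrom-prepend : ∀ q → AllWellFormed p → AllWellFormed R
  → (∀ {F} → F ∈ R → ∀ {v} → v ∈ₛ verts F → v ∈ₛ Vfam q → v ∈ₛ Vfam p)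
  → AdmFrom p R → AdmFrom (q ++ p) R
AdmFrom-prepend q wf-p wf-R inVfam =
  AdmFrom-transfer wf-R
    (λ F∈R v∈F v∈ → [ inVfam F∈R v∈F , id ]′ (Vfam-++⁻ q v∈))
    (λ _ _ _ f∈p → (λ v∈ → Vfam-mono (∈-++⁺ʳ q) (edge⊆Vfam wf-p f∈p v∈)) , ++⁺ʳ q f∈p)

-- A copy of e⁺ adds no vertex, and its only edge e is harmless once some earlier copy has
-- e as an edge, or when no later copy does.
AdmFrom-dropCopy : AllWellFormed p → AllWellFormed R → E ≈H (e ⁺)
  → Any (λ G → e ∈ edges G) p ⊎ ¬ Any (λ G → e ∈ edges G) R
  → AdmFrom (p ++ [ E ]) R → AdmFrom p R
AdmFrom-dropCopy {p = p} {R = R} {E = E} {e = e} wf-p wf-R E≈e⁺ anchor =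
  AdmFrom-transfer wf-R (λ _ _ → Vfam-mono {p = p} ∈-++⁺ˡ) inEdges
  where
  inEdges : ∀ {F} → F ∈ R → ∀ f → f ∈ edges F → Any (λ G → f ∈ edges G) (p ++ [ E ])
    → f ⊆ₛ Vfam p × Any (λ G → f ∈ edges G) p
  inEdges F∈R f f∈F f∈ with ++⁻ p f∈
  ... | inj₁ f∈p = edge⊆Vfam wf-p f∈p , f∈p
  ... | inj₂ (here f∈E) with edge-of-copy E≈e⁺ f∈E
  ...   | refl = [ (λ e∈p → (λ {_} → edge⊆Vfam wf-p e∈p) , e∈p)
                 , (λ e∉R → ⊥-elim (e∉R (lose F∈R f∈F))) ]′ anchor

Admissible-dropCopy : ∀ xs → AllWellFormed (xs ++ E ∷ ys) → E ≈H (e ⁺) → Any (λ G → e ∈ edges G) xs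
  → Admissible (xs ++ E ∷ ys) → Admissible (xs ++ ys)
Admissible-dropCopy xs wf E≈e⁺ e∈xs adm with AdmFrom-++⁻ [] xs adm
... | adm-xs , _ , adm-ys =
  AdmFrom-++⁺ [] xs adm-xs
    (AdmFrom-dropCopy (wf ∘ ∈-++⁺ˡ) (wf ∘ ∈-++⁺ʳ xs ∘ there) E≈e⁺ (inj₁ e∈xs) adm-ys)

IsParent : List (Hyp n) → Hyp n → Hyp n → Set
IsParent xs x F = F ∈ xs × verts x ∩ Vfam xs ⊆ₛ verts F × AdmStep [ x ] F

∩Vfam-swap : ∀ {F} (x : Hyp n) → F ∈ xs → verts F ∩ Vfam [ x ] ⊆ₛ verts x ∩ Vfam xs
∩Vfam-swap x F∈xs v∈ = x∈p∩q⁺ (Vfam-[-]⁻ x (∩⁻ʳ v∈) , ∈-Vfam F∈xs (∩⁻ˡ v∈))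

AdmStep⇒parent : AllWellFormed xs → AdmStep xs x → ∃ (IsParent xs x) ⊎ Empty (verts x ∩ Vfam xs)
AdmStep⇒parent {xs = xs} {x = x} wf (inj₁ (z∈x , z∈xs)) with find z∈xs
... | F , F∈xs , z∈F =
  inj₁ (F , F∈xs , z⊆F , inj₁ (subst (λ z → z ∈ edges F × Any (λ G → z ∈ edges G) [ x ])
                                     (⊆-antisym z⊆z′ (∩Vfam-swap x F∈xs)) (z∈F , here z∈x)))
  where
  z⊆F : verts x ∩ Vfam xs ⊆ₛ verts F
  z⊆F = wf F∈xs _ z∈F
  z⊆z′ : verts x ∩ Vfam xs ⊆ₛ verts F ∩ Vfam [ x ]
  z⊆z′ v∈ = x∈p∩q⁺ (z⊆F v∈ , Vfam⁺ {p = [ x ]} (here (∩⁻ˡ v∈)))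
AdmStep⇒parent {xs = xs} {x = x} wf (inj₂ ∣z∣≤1) with nonempty? (verts x ∩ Vfam xs)
... | no empty = inj₂ empty
... | yes (v , v∈z) with find (Vfam⁻ xs (∩⁻ʳ v∈z))
...   | F , F∈xs , v∈F =
  inj₁ (F , F∈xs , (λ w∈z → subst (_∈ₛ verts F) (∣s∣≤1⇒≡ _ ∣z∣≤1 v∈z w∈z) v∈F)
       , inj₂ (≤-trans (p⊆q⇒∣p∣≤∣q∣ (∩Vfam-swap x F∈xs)) ∣z∣≤1))

Rerootable : List (Hyp n) → Set
Rerootable L = ∀ {G} → G ∈ L → ∃[ R ] Admissible (G ∷ R) × L ↭ G ∷ R

-- The last copy either meets nothing before it, and may go first, or goes first followed
-- by its parent, whose later copies met x only inside that parent.
rerootable-last : AllWellFormed (xs ++ [ x ]) → Admissible (xs ++ [ x ]) → Rerootable xs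
  → ∃[ R ] Admissible (x ∷ R) × xs ++ [ x ] ↭ x ∷ R
rerootable-last {xs = xs} {x = x} wf adm reroot-xs with AdmFrom-++⁻ [] xs adm
... | adm-xs , x-step , _ with AdmStep⇒parent (wf ∘ ∈-++⁺ˡ) x-step
...   | inj₂ empty =
  xs , (AdmStep-[] x , AdmFrom-prepend [ x ] (λ ()) (wf ∘ ∈-++⁺ˡ) meets adm-xs) , ↭-sym (∷↭∷ʳ x xs)
  where
  meets : ∀ {F} → F ∈ xs → ∀ {v} → v ∈ₛ verts F → v ∈ₛ Vfam [ x ] → v ∈ₛ Vfam []
  meets F∈xs v∈F v∈x = ⊥-elim (empty (_ , x∈p∩q⁺ (Vfam-[-]⁻ x v∈x , ∈-Vfam F∈xs v∈F)))
...   | inj₁ (F , F∈xs , x∩xs⊆F , F-step) with reroot-xs F∈xs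
...     | R , (_ , adm-R) , xs↭FR =
  F ∷ R , (AdmStep-[] x , F-step , AdmFrom-prepend [ x ] wf-F (wf ∘ ∈-++⁺ˡ ∘ R⊆xs) meets adm-R)
  , ↭-trans (↭-sym (∷↭∷ʳ x xs)) (prep x xs↭FR)
  where
  R⊆xs : ∀ {G} → G ∈ R → G ∈ xs
  R⊆xs = ∈-resp-↭ (↭-sym xs↭FR) ∘ there
  wf-F : AllWellFormed [ F ]
  wf-F (here refl) = wf (∈-++⁺ˡ F∈xs)
  meets : ∀ {G} → G ∈ R → ∀ {v} → v ∈ₛ verts G → v ∈ₛ Vfam [ x ] → v ∈ₛ Vfam [ F ]
  meets G∈R v∈G v∈x =
    Vfam⁺ {p = [ F ]} (here (x∩xs⊆F (x∈p∩q⁺ (Vfam-[-]⁻ x v∈x , ∈-Vfam (R⊆xs G∈R) v∈G))))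

rerootable-∷ʳ : AllWellFormed (xs ++ [ x ]) → Admissible (xs ++ [ x ]) → Rerootable xs
  → Rerootable (xs ++ [ x ])
rerootable-∷ʳ {xs = xs} {x = x} wf adm reroot-xs G∈ with ∈-++⁻ xs G∈
... | inj₂ (here refl) = rerootable-last wf adm reroot-xs
... | inj₁ G∈xs with reroot-xs G∈xs | AdmFrom-++⁻ [] xs adm
...   | R , adm-GR , xs↭GR | _ , x-step , _ =
  R ++ [ x ] , AdmFrom-++⁺ [] (_ ∷ R) adm-GR (AdmStep-resp-↭ xs↭GR x-step , tt) , ↭-++⁺ʳ [ x ] xs↭GR

rerootable : {L : List (Hyp n)} → Reverse L → AllWellFormed L → Admissible L → Rerootable L
rerootable [] _ _ ()
rerootable (xs ∶ rxs ∶ʳ x) wf adm =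
  rerootable-∷ʳ wf adm (rerootable rxs (wf ∘ ∈-++⁺ˡ) (proj₁ (AdmFrom-++⁻ [] xs adm)))

reroot : {L : List (Hyp n)} → AllWellFormed L → Admissible L → Rerootable L
reroot {L = L} = rerootable (reverseView L)

-- After rerooting at a copy F having e as an edge, the copy E of e⁺ comes after F and
-- can be removed.
removeCopy : ∀ {E F Q} → AllWellFormed (E ∷ Q) → E ≈H (e ⁺) → (∀ {G} → G ∈ Q → ¬ (G ≈H (e ⁺)))
  → F ∈ Q → e ∈ edges F → ∃[ R ] Admissible (F ∷ R) × E ∷ Q ↭ F ∷ R → ∃[ P ] Admissible P × Q ↭ P
removeCopy wf E≈e⁺ Q≉e⁺ F∈Q e∈F (R , adm-FR , EQ↭FR) with ∈-resp-↭ EQ↭FR (here refl)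
... | here refl = ⊥-elim (Q≉e⁺ F∈Q E≈e⁺)
... | there E∈R with ∈-∃++ E∈R
...   | R₁ , R₂ , refl =
  (_ ∷ R₁) ++ R₂ , Admissible-dropCopy (_ ∷ R₁) (wf ∘ ∈-resp-↭ (↭-sym EQ↭FR)) E≈e⁺ (here e∈F) adm-FR
  , drop-∷ (↭-trans EQ↭FR (shift _ (_ ∷ R₁) R₂))

dropCopy : ∀ {E Q} → AllWellFormed (E ∷ Q) → Admissible (E ∷ Q) → E ≈H (e ⁺)
  → (∀ {G} → G ∈ Q → ¬ (G ≈H (e ⁺))) → ∃[ P ] Admissible P × Q ↭ P
dropCopy {e = e} {Q = Q} wf adm E≈e⁺ Q≉e⁺ with Any.any? (edge? e) Q
... | no e∉Q = Q , AdmFrom-dropCopy (λ ()) (wf ∘ there) E≈e⁺ (inj₂ e∉Q) (proj₂ adm) , ↭-refl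
... | yes e∈Q with find e∈Q
...   | F , F∈Q , e∈F = removeCopy wf E≈e⁺ Q≉e⁺ F∈Q e∈F (reroot wf adm (there F∈Q))

record RootedForest (e : Subset n) (𝓐 : List (Hyp n)) : Set where
  field
    root       : Hyp n
    rest       : List (Hyp n)
    root≈e⁺    : root ≈H (e ⁺)
    enumerates : IsEnumerationOf (root ∷ rest) (e ⁺ ∷ 𝓐)
    admissible : Admissible (root ∷ rest)
    wellFormed : AllWellFormed (root ∷ rest)

  rest≉e⁺ : ∀ {G} → G ∈ rest → ¬ (G ≈H (e ⁺))
  rest≉e⁺ G∈ G≈e⁺ =
    All.lookup (AllPairs.head (proj₁ enumerates)) G∈ (≈H-trans root≈e⁺ (≈H-sym G≈e⁺))

  rest-enumerates : ¬ Any ((e ⁺) ≈H_) 𝓐 → IsEnumerationOf rest 𝓐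
  rest-enumerates noCopy = AllPairs.tail (proj₁ enumerates) , cover , back
    where
    cover : ∀ A → A ∈ 𝓐 → Any (A ≈H_) rest
    cover A A∈ with proj₁ (proj₂ enumerates) A (there A∈)
    ... | here A≈root = ⊥-elim (noCopy (lose A∈ (≈H-sym (≈H-trans A≈root root≈e⁺))))
    ... | there A∈rest = A∈rest
    back : ∀ G → G ∈ rest → Any (G ≈H_) 𝓐
    back G G∈ with proj₂ (proj₂ enumerates) G (there G∈)
    ... | here G≈e⁺ = ⊥-elim (rest≉e⁺ G∈ G≈e⁺)
    ... | there G≈A = G≈A

  root∷rest-enumerates : Any ((e ⁺) ≈H_) 𝓐 → IsEnumerationOf (root ∷ rest) 𝓐
  root∷rest-enumerates copy = proj₁ enumerates , (λ A → proj₁ (proj₂ enumerates) A ∘ there) , back′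
    where
    back′ : ∀ G → G ∈ root ∷ rest → Any (G ≈H_) 𝓐
    back′ G G∈ with proj₂ (proj₂ enumerates) G G∈
    ... | here G≈e⁺ = Any.map (≈H-trans G≈e⁺) copy
    ... | there G≈A = G≈A

rootedForest : AllWellFormed 𝓐 → IsForestOfCopies ((e ⁺) ∷ 𝓐) → RootedForest e 𝓐
rootedForest {𝓐 = 𝓐} {e = e} wf (M , enum , adm) =
  root-at (find (proj₁ (proj₂ enum) (e ⁺) (here refl)))
  where
  wf-M : AllWellFormed M
  wf-M = enumeration-wellFormed enum λ { (here refl) → ⁺-wellFormed ; (there A∈) → wf A∈ }
  root-at : ∃[ E ] E ∈ M × (e ⁺) ≈H E → RootedForest e 𝓐
  root-at (E , E∈M , e⁺≈E) with reroot wf-M adm E∈M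
  ... | R , adm-ER , M↭ER = record
    { root = E ; rest = R ; root≈e⁺ = ≈H-sym e⁺≈E
    ; enumerates = IsEnumerationOf-resp-↭ˡ M↭ER enum ; admissible = adm-ER
    ; wellFormed = wf-M ∘ ∈-resp-↭ (↭-sym M↭ER) }

IsForestOfCopies-∷⁻ : AllWellFormed 𝓐 → IsForestOfCopies ((e ⁺) ∷ 𝓐) → IsForestOfCopies 𝓐
IsForestOfCopies-∷⁻ {𝓐 = 𝓐} {e = e} wf forest = unroot (Any.any? (≈H-dec (e ⁺)) 𝓐)
  where
  open RootedForest (rootedForest wf forest)
  unroot : Dec (Any ((e ⁺) ≈H_) 𝓐) → IsForestOfCopies 𝓐
  unroot (yes copy) = root ∷ rest , root∷rest-enumerates copy , admissible
  unroot (no noCopy) with dropCopy wellFormed admissible root≈e⁺ rest≉e⁺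
  ... | P , adm-P , rest↭P = P , IsEnumerationOf-resp-↭ˡ rest↭P (rest-enumerates noCopy) , adm-P

-- The copy of e⁺ rooting 𝓑 is replaced by all of 𝓐: it held every vertex 𝓑 shares with 𝓐,
-- and its edge e is available in 𝓐 whenever some copy of 𝓑 needs it.
IsForestOfCopies-++ : AllWellFormed 𝓐 → AllWellFormed 𝓑
  → (∀ A B → A ∈ 𝓐 → B ∈ 𝓑 → ¬ (A ≈H B))
  → (∀ (v : Fin n) → v ∈ₛ Vfam 𝓐 → v ∈ₛ Vfam 𝓑 → v ∈ₛ e)
  → IsForestOfCopies 𝓐 → IsForestOfCopies ((e ⁺) ∷ 𝓑) → ¬ Any ((e ⁺) ≈H_) 𝓑
  → Any (λ A → e ∈ edges A) 𝓐 ⊎ ¬ Any (λ B → e ∈ edges B) 𝓑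
  → IsForestOfCopies (𝓐 ++ 𝓑)
IsForestOfCopies-++ {𝓐 = 𝓐} {𝓑 = 𝓑} {e = e} wf𝓐 wf𝓑 disjoint meet⊆e (M , enum-M , adm-M) forest𝓑
                    noCopy anchor =
  M ++ rest , IsEnumerationOf-++ enum-M enum-rest disjoint , AdmFrom-++⁺ [] M adm-M adm-rest
  where
  open RootedForest (rootedForest wf𝓑 forest𝓑)
  enum-rest : IsEnumerationOf rest 𝓑
  enum-rest = rest-enumerates noCopy
  wf-M : AllWellFormed M
  wf-M = enumeration-wellFormed enum-M wf𝓐
  inRoot : ∀ {F} → F ∈ rest → ∀ {v} → v ∈ₛ verts F → v ∈ₛ Vfam M → v ∈ₛ Vfam [ root ]
  inRoot F∈ v∈F v∈M = Vfam⁺ {p = [ root ]} (here (≈H-verts (≈H-sym root≈e⁺)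
    (meet⊆e _ (Vfam-enumeration enum-M v∈M) (Vfam-enumeration enum-rest (∈-Vfam F∈ v∈F)))))
  anchor′ : Any (λ G → e ∈ edges G) M ⊎ ¬ Any (λ G → e ∈ edges G) rest
  anchor′ = Sum.map (Any-resp-enumeration ≈H-edges enum-M)
                    (λ e∉𝓑 → e∉𝓑 ∘ Any-resp-enumeration⁻ ≈H-edges enum-rest) anchor
  adm-rest : AdmFrom M rest
  adm-rest = AdmFrom-dropCopy wf-M (wellFormed ∘ there) root≈e⁺ anchor′
    (AdmFrom-prepend M (λ { (here refl) → wellFormed (here refl) }) (wellFormed ∘ there) inRoot
                     (proj₂ admissible))

IsForestOfCopies-glue : AllWellFormed 𝓐 → AllWellFormed 𝓑
  → (∀ A B → A ∈ 𝓐 → B ∈ 𝓑 → ¬ (A ≈H B))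
  → (∀ (v : Fin n) → v ∈ₛ Vfam 𝓐 → v ∈ₛ Vfam 𝓑 → v ∈ₛ e)
  → IsForestOfCopies ((e ⁺) ∷ 𝓐) → IsForestOfCopies ((e ⁺) ∷ 𝓑) → IsForestOfCopies (𝓐 ++ 𝓑)
IsForestOfCopies-glue {𝓐 = 𝓐} {𝓑 = 𝓑} {e = e} wf𝓐 wf𝓑 disjoint meet⊆e forest𝓐 forest𝓑 =
  glue (Any.any? (≈H-dec (e ⁺)) 𝓑) (Any.any? (edge? e) 𝓐)
  where
  glue𝓐𝓑 : ¬ Any ((e ⁺) ≈H_) 𝓑 → Any (λ A → e ∈ edges A) 𝓐 ⊎ ¬ Any (λ B → e ∈ edges B) 𝓑
    → IsForestOfCopies (𝓐 ++ 𝓑)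
  glue𝓐𝓑 = IsForestOfCopies-++ wf𝓐 wf𝓑 disjoint meet⊆e (IsForestOfCopies-∷⁻ wf𝓐 forest𝓐) forest𝓑
  glue𝓑𝓐 : ¬ Any ((e ⁺) ≈H_) 𝓐 → Any (λ B → e ∈ edges B) 𝓑 ⊎ ¬ Any (λ A → e ∈ edges A) 𝓐
    → IsForestOfCopies (𝓐 ++ 𝓑)
  glue𝓑𝓐 noCopy anchor = IsForestOfCopies-++-comm 𝓐 𝓑
    (IsForestOfCopies-++ wf𝓑 wf𝓐 (λ B A B∈ A∈ B≈A → disjoint A B A∈ B∈ (≈H-sym B≈A))
       (λ v v∈𝓑 v∈𝓐 → meet⊆e v v∈𝓐 v∈𝓑) (IsForestOfCopies-∷⁻ wf𝓑 forest𝓑) forest𝓐 noCopy anchor)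
  unshared : Any ((e ⁺) ≈H_) 𝓐 → ¬ Any ((e ⁺) ≈H_) 𝓑
  unshared copy𝓐 copy𝓑 with find copy𝓐 | find copy𝓑
  ... | A , A∈ , e⁺≈A | B , B∈ , e⁺≈B = disjoint A B A∈ B∈ (≈H-trans (≈H-sym e⁺≈A) e⁺≈B)
  glue : Dec (Any ((e ⁺) ≈H_) 𝓑) → Dec (Any (λ A → e ∈ edges A) 𝓐) → IsForestOfCopies (𝓐 ++ 𝓑)
  glue (yes copy𝓑) _ = glue𝓑𝓐 (λ copy𝓐 → unshared copy𝓐 copy𝓑) (inj₁ (copy⇒edge copy𝓑))
  glue (no noCopy𝓑) (yes e∈𝓐) = glue𝓐𝓑 noCopy𝓑 (inj₁ e∈𝓐)
  glue (no _) (no e∉𝓐) = glue𝓑𝓐 (e∉𝓐 ∘ copy⇒edge) (inj₂ e∉𝓐)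

lemma13p6 : (n k : ℕ) (H : Hyp n) → IsUniformHypergraph k H → IsLinear H
    → (𝓐 𝓑 : List (Hyp n))
    → (∀ F → F ∈ 𝓐 → IsSubhypergraph F H)
    → (∀ F → F ∈ 𝓑 → IsSubhypergraph F H)
    → (∀ A B → A ∈ 𝓐 → B ∈ 𝓑 → ¬ (A ≈H B))
    → (e : Subset n) → e ∈ edges H
    → (∀ (v : Fin n) → v ∈ₛ Vfam 𝓐 → v ∈ₛ Vfam 𝓑 → v ∈ₛ e)
    → IsForestOfCopies ((e ⁺) ∷ 𝓐)
    → IsForestOfCopies ((e ⁺) ∷ 𝓑)
    → IsForestOfCopies (𝓐 ++ 𝓑)
lemma13p6 n k H _ _ 𝓐 𝓑 sub𝓐 sub𝓑 disjoint e _ =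
  IsForestOfCopies-glue (λ A∈ → proj₂ (proj₂ (sub𝓐 _ A∈))) (λ B∈ → proj₂ (proj₂ (sub𝓑 _ B∈)))
                        disjoint
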